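{- Let $K$ be a finite poset, $P\in\mathrm{Or}(K)$ idempotent, and $u,v\in K\setminus\mathrm{Im}(P)$ with $u\leqslant v$. Then $[u,v]\subseteq K\setminus\mathrm{Im}(P)$ if and only if it is not the case that $u<P(v)$.
   Context: $\mathrm{Or}(K)$ is the monoid under composition of order preserving regressive ($f(x)\leqslant x$) maps $K\to K$; $[u,v]=\{z:u\leqslant z\leqslant v\}$. -}

module Defs where

open import Level using (0ℓ)
open import Data.Nat using (ℕ)
open import Data.Fin using (Fin)
open import Data.Product using (Σ; ∃; _×_)
open import Relation.Nullary using (¬_)
open import Relation.Binary.PropositionalEquality using (_≡_; _≢_)
open import Relation.Binary.Structures using (IsPartialOrder)
open import Function.Bundles using (_↔_)

record FinitePoset : Set₁ where
  field
    Carrier        : Set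
    _≤_            : Carrier → Carrier → Set
    isPartialOrder : IsPartialOrder _≡_ _≤_
    size           : ℕ
    enum           : Carrier ↔ Fin size

  _<_ : Carrier → Carrier → Set
  u < w = u ≤ w × u ≢ w

  [_,_] : Carrier → Carrier → Carrier → Set
  [ u , v ] z = u ≤ z × z ≤ v

module _ (K : FinitePoset) where
  open FinitePoset K

  record Or : Set where
    field
      fun        : Carrier → Carrier
      monotone   : ∀ {x y} → x ≤ y → fun x ≤ fun y
      regressive : ∀ x → fun x ≤ x

  Idempotent : Or → Set
  Idempotent P = ∀ x → Or.fun P (Or.fun P x) ≡ Or.fun P x

  Im : Or → Carrier → Set
  Im P z = ∃ λ x → Or.fun P x ≡ z

{-# OPTIONS --safe #-}
module Submission where

-- Points of Im(P) are exactly the fixed points of P, and a fixed point z ≤ v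
-- satisfies z = P z ≤ P v.  So an image point in [u,v] forces u ≤ P v, with
-- u ≠ P v because u ∉ Im(P); conversely, if u < P v then P v itself is an image
-- point of [u,v], as P is regressive.

open import Defs
open import Data.Product using (_,_)
open import Relation.Nullary using (¬_)
open import Function.Bundles using (_⇔_; mk⇔)
open import Relation.Binary.PropositionalEquality using (_≡_; refl; sym; subst)
open import Relation.Binary.Structures using (IsPartialOrder)

module _ (K : FinitePoset) (P : Or K) where
  open FinitePoset K
  open Or P renaming (fun to f)

  image-fixed : Idempotent K P → ∀ {z} → Im K P z → f z ≡ z
  image-fixed idem (x , refl) = idem x

  fixed≤⇒≤fun : ∀ {z v} → f z ≡ z → z ≤ v → z ≤ f v
  fixed≤⇒≤fun fz≡z z≤v = subst (_≤ f _) fz≡z (monotone z≤v)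

  fun∈[_,_] : ∀ {u} v → u ≤ f v → [ u , v ] (f v)
  fun∈[ v , u≤fv ] = u≤fv , regressive v

lemma3p10 : (K : FinitePoset) (P : Or K) → Idempotent K P →
    (u v : FinitePoset.Carrier K) → ¬ Im K P u → ¬ Im K P v →
    FinitePoset._≤_ K u v →
    ((∀ z → FinitePoset.[_,_] K u v z → ¬ Im K P z)
    ⇔ (¬ FinitePoset._<_ K u (Or.fun P v)))
lemma3p10 K P idem u v u∉Im _ _ = mk⇔ to from
  where
  open FinitePoset K
  open IsPartialOrder isPartialOrder using (trans)

  to : (∀ z → [ u , v ] z → ¬ Im K P z) → ¬ (u < Or.fun P v)
  to avoids (u≤fv , _) = avoids (Or.fun P v) (fun∈[_,_] K P v u≤fv) (v , refl)

  from : ¬ (u < Or.fun P v) → ∀ z → [ u , v ] z → ¬ Im K P z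
  from u≮fv z (u≤z , z≤v) z∈Im = u≮fv (u≤fv , λ u≡fv → u∉Im (v , sym u≡fv))
    where
    u≤fv : u ≤ Or.fun P v
    u≤fv = trans u≤z (fixed≤⇒≤fun K P (image-fixed K P idem z∈Im) z≤v)
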